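{- For every integer $m\ge 2$, the line graph $L(\Gamma(\mathbb{Z}_{2^m}[i]))$ is pancyclic.
   Context: $\mathbb{Z}_n[i]=\mathbb{Z}[i]/\langle n\rangle=\{a+bi : a,b\in\mathbb{Z}_n\}$ with $i^2=-1$. For a finite commutative ring $R$ with unity, $\Gamma(R)$ has vertex set the nonzero zero-divisors of $R$, distinct $x,y$ adjacent iff $xy=0$. The line graph $L(G)$ has the edges of $G$ as vertices, two being adjacent iff they share an endpoint in $G$. A graph of order $N$ is pancyclic if $N\ge 3$ and it contains a cycle of length $k$ for every $3\le k\le N$. -}

module Defs where

open import Data.Nat using (ℕ; zero; suc; _+_; _*_; _∸_; _^_; _≤_; _<ᵇ_; NonZero)
open import Data.Nat.DivMod using (_%_; m%n<n)
open import Data.Nat.Properties using (m^n≢0)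
open import Data.Fin using (Fin; toℕ; fromℕ<)
open import Data.Fin.Properties using () renaming (_≟_ to _≟ᶠ_)
open import Data.Bool using (Bool; true; false; _∧_; not; T)
open import Data.Product using (Σ; _×_; _,_; proj₁; proj₂)
open import Data.Sum using (_⊎_)
open import Relation.Binary.PropositionalEquality using (_≡_; _≢_)
open import Relation.Nullary.Decidable using (⌊_⌋)
open import Function.Bundles using (_↔_)
open import Function.Definitions using (Injective)

record Graph : Set₁ where
  field
    V   : Set
    Adj : V → V → Set

open Graph public

-- A cycle of length k: k pairwise distinct vertices f 0, …, f (k-1)
-- with f i adjacent to f (i+1 mod k).
Consecutive : (k : ℕ) → Fin k → Fin k → Set
Consecutive k i j = (toℕ j ≡ suc (toℕ i)) ⊎ ((suc (toℕ i) ≡ k) × (toℕ j ≡ 0))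

HasCycleOfLength : (G : Graph) → ℕ → Set
HasCycleOfLength G k =
  Σ (Fin k → V G) λ f →
    Injective _≡_ _≡_ f × (∀ i j → Consecutive k i j → Adj G (f i) (f j))

Pancyclic : Graph → Set
Pancyclic G =
  Σ ℕ λ N → (Fin N ↔ V G) × (3 ≤ N) ×
    (∀ k → 3 ≤ k → k ≤ N → HasCycleOfLength G k)

modFin : (n : ℕ) → .{{_ : NonZero n}} → ℕ → Fin n
modFin n x = fromℕ< (m%n<n x n)

ZnI : ℕ → Set
ZnI n = Fin n × Fin n      -- (a , b) represents a + b i

module _ (n : ℕ) .{{_ : NonZero n}} where

  zeroZnI : ZnI n
  zeroZnI = (modFin n 0 , modFin n 0)

  -- (a + b i)(c + d i) = (ac - bd) + (ad + bc) i ;  -1 ≡ n - 1 (mod n)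
  mulZnI : ZnI n → ZnI n → ZnI n
  mulZnI (a , b) (c , d) =
    ( modFin n (toℕ a * toℕ c + (n ∸ 1) * (toℕ b * toℕ d))
    , modFin n (toℕ a * toℕ d + toℕ b * toℕ c) )

  isZero : ZnI n → Bool
  isZero (a , b) = ⌊ a ≟ᶠ proj₁ zeroZnI ⌋ ∧ ⌊ b ≟ᶠ proj₂ zeroZnI ⌋

  -- an injective code, used only to pick one orientation of each edge
  code : ZnI n → ℕ
  code (a , b) = toℕ a * n + toℕ b

  isEdgeΓ : ZnI n → ZnI n → Bool
  isEdgeΓ x y = (code x <ᵇ code y) ∧ not (isZero x) ∧ not (isZero y)
                ∧ isZero (mulZnI x y)

  -- edges of Γ(ℤ_n[i]), each unordered edge {x,y} appearing exactly once
  EdgeΓ : Set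
  EdgeΓ = Σ (ZnI n × ZnI n) λ p → T (isEdgeΓ (proj₁ p) (proj₂ p))

  endpoint₁ endpoint₂ : EdgeΓ → ZnI n
  endpoint₁ e = proj₁ (proj₁ e)
  endpoint₂ e = proj₂ (proj₁ e)

  ShareEndpoint : EdgeΓ → EdgeΓ → Set
  ShareEndpoint e f =
    (endpoint₁ e ≡ endpoint₁ f) ⊎ (endpoint₁ e ≡ endpoint₂ f)
    ⊎ (endpoint₂ e ≡ endpoint₁ f) ⊎ (endpoint₂ e ≡ endpoint₂ f)

  LineGraphΓ : Graph
  LineGraphΓ = record
    { V   = EdgeΓ
    ; Adj = λ e f → (e ≢ f) × ShareEndpoint e f }

LΓZ2^m[i] : ℕ → Graph
LΓZ2^m[i] m = LineGraphΓ (2 ^ m) {{m^n≢0 2 m}}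

module Submission where

-- Write n = 2^m = 2h and z = h(1 + i).  A zero-divisor a + bi of ℤ_n[i] has a + b even:
-- otherwise its norm a² + b² is odd, hence a unit modulo 2^m, and (a² + b²) y = x̄ x y = 0
-- forces y = 0.  Conversely z annihilates every a + bi with a + b even.  So in Γ(ℤ_n[i]) the
-- vertex z is joined to every other vertex, and 1 + i, 2, 2i are three of its neighbours.
-- The theorem then follows from a purely combinatorial fact (`LineGraphs.Cone`): if a graph
-- has a vertex z with at least three neighbours that is joined to every other vertex lying on
-- an edge, its line graph is pancyclic.  A cycle of length k ≤ deg z consists of k edges at z,
-- which pairwise meet at z; a longer cycle uses all edges at z and threads each further edge
-- {x,y} between the edges {z,x} and {z,y} (the blocks of `Tours`).

open import Defs
open import Data.Nat using (ℕ; zero; suc; _+_; _*_; _∸_; _^_; _≤_; _<_; z≤n; s≤s; _≤?_; _%_;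
  NonZero; >-nonZero⁻¹)
import Data.Nat.Properties as ℕ
open import Data.Nat.Properties using (+-comm; *-comm; *-distribˡ-+)
open import Data.Nat.DivMod using (m%n<n; m<n⇒m%n≡m)
open import Data.Nat.Divisibility using (_∣_; divides; _∣?_; ∣-refl; 1∣_; m∣m*n; ∣n⇒∣m*n;
  ∣m∣n⇒∣m+n; ∣m+n∣m⇒∣n; m*n∣⇒m∣; *-monoʳ-∣; *-cancelˡ-∣; m%n≡0⇒n∣m; n∣m⇒m%n≡0)
open import Data.Nat.Primality using (Prime; euclidsLemma; prime?)
open import Data.Nat.Tactic.RingSolver using (solve-∀)
open import Data.Fin using (Fin; toℕ; fromℕ<; combine) renaming (zero to fzero; suc to fsuc)
open import Data.Fin.Properties using (toℕ-fromℕ<; toℕ-injective; toℕ<n; toℕ-combine; combine-injective)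
  renaming (_≟_ to _≟ᶠ_)
open import Data.List using (List; []; _∷_; _++_; [_]; length; lookup; take; filter; concatMap;
  cartesianProduct; allFin)
open import Data.List.Properties using (++-assoc; length-++; length-take; length-filter; partition-defn)
open import Data.List.Relation.Unary.All as All using (All; []; _∷_)
import Data.List.Relation.Unary.All.Properties as All
open import Data.List.Relation.Unary.Any as Any using (Any; here; there)
open import Data.List.Relation.Unary.Any.Properties using (lookup-index)
open import Data.List.Relation.Unary.Unique.Propositional using (Unique; []; _∷_)
import Data.List.Relation.Unary.Unique.Propositional.Properties as Unique
open import Data.List.Membership.Propositional using (_∈_)
open import Data.List.Membership.Propositional.Properties
  using (∈-∃++; ∈-lookup; ∈-++⁻; ∈-filter⁺; ∈-filter⁻; ∈-cartesianProduct⁺; ∈-allFin)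
open import Data.List.Relation.Binary.Sublist.Propositional using (_⊆_; []; _∷_; _∷ʳ_; ⊆-refl)
open import Data.List.Relation.Binary.Sublist.Propositional.Properties using (All-resp-⊆; take-⊆)
import Data.List.Relation.Binary.Sublist.Propositional.Properties as Sublist
open import Data.List.Relation.Binary.Permutation.Propositional
  using (_↭_; ↭-refl; ↭-sym; ↭-trans; prep; swap; ↭⇒↭ₛ; ↭ₛ⇒↭; module PermutationReasoning)
open import Data.List.Relation.Binary.Permutation.Propositional.Properties
  using (∈-resp-↭; All-resp-↭; ↭-length; shift; shifts; ++⁺ˡ; ++⁺ʳ; ++⁺; ++-comm)
import Data.List.Relation.Binary.Permutation.Setoid.Properties as Perm
open import Data.Product using (Σ; _×_; _,_; proj₁; proj₂)
open import Data.Product.Properties using (≡-dec)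
open import Data.Sum using (_⊎_; inj₁; inj₂)
open import Data.Bool using (Bool; T; true; false; not)
open import Data.Bool.Properties using (T?; T-irrelevant; T-∧)
open import Data.Unit using (tt)
open import Data.Empty using (⊥-elim)
open import Function using (_∘_)
open import Function.Bundles using (_↔_; mk↔ₛ′; Equivalence)
open import Relation.Nullary using (¬_; Dec; yes; no)
open import Relation.Nullary.Decidable using (_⊎-dec_; from-yes; toWitness; fromWitness)
open import Relation.Unary.Properties using (∁?)
open import Relation.Binary.Definitions using (DecidableEquality; tri<; tri≈; tri>)
open import Relation.Binary.PropositionalEquality
  using (_≡_; _≢_; refl; sym; trans; cong; cong₂; subst; setoid; module ≡-Reasoning)

module ListFacts {A : Set} where

  private variable
    x y w : A
    xs ys : List A

  Unique-resp-↭ : xs ↭ ys → Unique xs → Unique ys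
  Unique-resp-↭ p = Perm.Unique-resp-↭ (setoid A) (↭⇒↭ₛ p)

  Unique-resp-⊇ : xs ⊆ ys → Unique ys → Unique xs
  Unique-resp-⊇ []         []       = []
  Unique-resp-⊇ (y ∷ʳ sub) (_ ∷ u)  = Unique-resp-⊇ sub u
  Unique-resp-⊇ (refl ∷ sub) (x∉ ∷ u) = All-resp-⊆ sub x∉ ∷ Unique-resp-⊇ sub u

  lookup-injective : Unique xs → ∀ {i j} → lookup xs i ≡ lookup xs j → i ≡ j
  lookup-injective (_  ∷ _) {fzero}  {fzero}  _  = refl
  lookup-injective (x∉ ∷ _) {fzero}  {fsuc j} eq = ⊥-elim (All.lookup x∉ (∈-lookup j) eq)
  lookup-injective (x∉ ∷ _) {fsuc i} {fzero}  eq = ⊥-elim (All.lookup x∉ (∈-lookup i) (sym eq))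
  lookup-injective (_  ∷ u) {fsuc i} {fsuc j} eq = cong fsuc (lookup-injective u eq)

  enumeration : Unique xs → (∀ x → x ∈ xs) → Fin (length xs) ↔ A
  enumeration {xs} u complete =
    mk↔ₛ′ (lookup xs) (λ x → Any.index (complete x))
      (λ x → sym (lookup-index (complete x)))
      (λ i → lookup-injective u (sym (lookup-index (complete (lookup xs i)))))

  remove : x ∈ xs → Σ (List A) λ rest → xs ↭ x ∷ rest
  remove {x} x∈xs with ys , zs , refl ← ∈-∃++ x∈xs = ys ++ zs , shift x ys zs

  remove₂ : x ∈ xs → y ∈ xs → x ≢ y → Σ (List A) λ rest → xs ↭ x ∷ y ∷ rest
  remove₂ {x} x∈xs y∈xs x≢y with rest , xs↭ ← remove x∈xs with ∈-resp-↭ xs↭ y∈xs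
  ... | here y≡x = ⊥-elim (x≢y (sym y≡x))
  ... | there y∈rest with rest′ , rest↭ ← remove y∈rest = rest′ , ↭-trans xs↭ (prep x rest↭)

  three≤length : x ∈ xs → y ∈ xs → w ∈ xs → x ≢ y → x ≢ w → y ≢ w → 3 ≤ length xs
  three≤length x∈ y∈ w∈ x≢y x≢w y≢w with rest , xs↭ ← remove₂ x∈ y∈ x≢y with ∈-resp-↭ xs↭ w∈
  ... | here w≡x             = ⊥-elim (x≢w (sym w≡x))
  ... | there (here w≡y)     = ⊥-elim (y≢w (sym w≡y))
  ... | there (there w∈rest) =
    subst (3 ≤_) (sym (↭-length xs↭)) (s≤s (s≤s (nonempty w∈rest)))
    where
    nonempty : ∀ {zs} → w ∈ zs → 1 ≤ length zs
    nonempty (here _)  = s≤s z≤n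
    nonempty (there _) = s≤s z≤n

  witnesses : (p : A → Bool) → List A → List (Σ A (T ∘ p))
  witnesses p []       = []
  witnesses p (x ∷ xs) with T? (p x)
  ... | yes px = (x , px) ∷ witnesses p xs
  ... | no  _  = witnesses p xs

  witnesses-sound : ∀ p {s} → s ∈ witnesses p xs → proj₁ s ∈ xs
  witnesses-sound {xs = x ∷ xs} p s∈ with T? (p x) | s∈
  ... | yes _ | here refl = here refl
  ... | yes _ | there s∈′ = there (witnesses-sound p s∈′)
  ... | no  _ | s∈′       = there (witnesses-sound p s∈′)

  witnesses-complete : ∀ p (s : Σ A (T ∘ p)) → proj₁ s ∈ xs → s ∈ witnesses p xs
  witnesses-complete {xs = x ∷ xs} p (y , py) y∈ with T? (p x) | y∈
  ... | yes px | here refl = here (cong (x ,_) (T-irrelevant py px))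
  ... | yes _  | there y∈′ = there (witnesses-complete p (y , py) y∈′)
  ... | no ¬px | here refl = ⊥-elim (¬px py)
  ... | no _   | there y∈′ = witnesses-complete p (y , py) y∈′

  witnesses-unique : ∀ p → Unique xs → Unique (witnesses p xs)
  witnesses-unique {xs = []}     p []       = []
  witnesses-unique {xs = x ∷ xs} p (x∉ ∷ u) with T? (p x)
  ... | yes _ = All.tabulate (λ s∈ s≡ → All.lookup x∉ (witnesses-sound p s∈) (cong proj₁ s≡))
                ∷ witnesses-unique p u
  ... | no  _ = witnesses-unique p u

open ListFacts

module LineGraphs {Edge Vertex : Set} (end₁ end₂ : Edge → Vertex)
                  (_≟_ : DecidableEquality Vertex) where

  private variable
    u v w : Vertex
    e k   : Edge
    es fs : List Edge

  infix 4 _∋_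
  _∋_ : Edge → Vertex → Set
  e ∋ v = end₁ e ≡ v ⊎ end₂ e ≡ v

  _∋?_ : ∀ e v → Dec (e ∋ v)
  e ∋? v = (end₁ e ≟ v) ⊎-dec (end₂ e ≟ v)

  -- e and f have a common endpoint (spelled out as in `Defs`)
  Share : Edge → Edge → Set
  Share e f = (end₁ e ≡ end₁ f) ⊎ (end₁ e ≡ end₂ f) ⊎ (end₂ e ≡ end₁ f) ⊎ (end₂ e ≡ end₂ f)

  share : ∀ {f} → e ∋ v → f ∋ v → Share e f
  share (inj₁ p) (inj₁ q) = inj₁ (trans p (sym q))
  share (inj₁ p) (inj₂ q) = inj₂ (inj₁ (trans p (sym q)))
  share (inj₂ p) (inj₁ q) = inj₂ (inj₂ (inj₁ (trans p (sym q))))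
  share (inj₂ p) (inj₂ q) = inj₂ (inj₂ (inj₂ (trans p (sym q))))

  LineGraph : Graph
  LineGraph = record { V = Edge ; Adj = λ e f → (e ≢ f) × Share e f }

  data Walk : Vertex → List Edge → Vertex → Set where
    []   : Walk v [] v
    step : e ∋ u → e ∋ v → Walk v es w → Walk u (e ∷ es) w

  infixr 5 _++ʷ_
  _++ʷ_ : Walk u es v → Walk v fs w → Walk u (es ++ fs) w
  []              ++ʷ q = q
  step eu ev p    ++ʷ q = step eu ev (p ++ʷ q)

  pivot : All (_∋ v) es → Walk v es v
  pivot []         = []
  pivot (e∋v ∷ ps) = step e∋v e∋v (pivot ps)

  closedWalk⇒cycle : Walk v es v → Unique es → 2 ≤ length es →
                     HasCycleOfLength LineGraph (length es)
  closedWalk⇒cycle {v} {es} walk u 2≤len = lookup es , lookup-injective u , adjacent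
    where
    first : ∀ {u es w} → Walk u es w → (j : Fin (length es)) → toℕ j ≡ 0 → lookup es j ∋ u
    first (step eu _ _) fzero _ = eu

    last : ∀ {u es w} → Walk u es w → (i : Fin (length es)) → suc (toℕ i) ≡ length es →
           lookup es i ∋ w
    last (step _ ev [])         fzero    _  = ev
    last (step _ _ (step _ _ _)) fzero    ()
    last (step _ _ p)           (fsuc i) eq = last p i (ℕ.suc-injective eq)

    next : ∀ {u es w} → Walk u es w → (i j : Fin (length es)) → toℕ j ≡ suc (toℕ i) →
           Share (lookup es i) (lookup es j)
    next (step _ ev (step eu _ _)) fzero    (fsuc fzero)    _  = share ev eu
    next (step _ _ p)              (fsuc i) (fsuc j)        eq = next p i j (ℕ.suc-injective eq)

    adjacent : ∀ i j → Consecutive (length es) i j →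
               (lookup es i ≢ lookup es j) × Share (lookup es i) (lookup es j)
    adjacent i j (inj₁ j≡1+i) =
      (λ eq → ℕ.1+n≢n (trans (sym j≡1+i) (cong toℕ (sym (lookup-injective u eq))))) ,
      next walk i j j≡1+i
    adjacent i j (inj₂ (1+i≡len , j≡0)) =
      (λ eq → 2≰1 (subst (2 ≤_) (len≡1 (trans (cong toℕ (lookup-injective u eq)) j≡0)) 2≤len)) ,
      share (last walk i 1+i≡len) (first walk j j≡0)
      where
      len≡1 : toℕ i ≡ 0 → length es ≡ 1
      len≡1 i≡0 = trans (sym 1+i≡len) (cong suc i≡0)
      2≰1 : ¬ 2 ≤ 1
      2≰1 (s≤s ())

  -- A fixed vertex z; the edges at z are called star edges.
  module Cone (z : Vertex) where

    other : Edge → Vertex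
    other e with end₁ e ≟ z
    ... | yes _ = end₂ e
    ... | no  _ = end₁ e

    ∋-other : ∀ e → e ∋ other e
    ∋-other e with end₁ e ≟ z
    ... | yes _ = inj₂ refl
    ... | no  _ = inj₁ refl

    other-unique : e ∋ z → e ∋ v → v ≢ z → other e ≡ v
    other-unique {e} e∋z e∋v v≢z with end₁ e ≟ z | e∋z | e∋v
    ... | yes e₁≡z | _          | inj₁ e₁≡v = ⊥-elim (v≢z (trans (sym e₁≡v) e₁≡z))
    ... | yes _    | _          | inj₂ e₂≡v = e₂≡v
    ... | no  e₁≢z | inj₁ e₁≡z  | _         = ⊥-elim (e₁≢z e₁≡z)
    ... | no  _    | inj₂ _     | inj₁ e₁≡v = e₁≡v
    ... | no  _    | inj₂ e₂≡z  | inj₂ e₂≡v = ⊥-elim (v≢z (trans (sym e₂≡v) e₂≡z))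

    far-ends-differ : ∀ {k′} → other k ≡ u → other k′ ≡ v → u ≢ v → k ≢ k′
    far-ends-differ k→u k′→v u≢v refl = u≢v (trans (sym k→u) k′→v)

    -- Every further
    -- edge {x,y} is placed in a *block*  {z,x} ⋯ edges at x ⋯ {x,y} ⋯ edges at y ⋯ {y,z},
    -- a closed walk at z; the blocks and the remaining star edges, one after another, form a closed
    -- walk at z through all star edges and all of S.
    module Tours (stars : List Edge) (stars-at-z : All (_∋ z) stars) where

      Reached : Vertex → Set
      Reached v = Σ Edge λ k → k ∈ stars × other k ≡ v

      Attachable : Edge → Set
      Attachable e = Reached (end₁ e) × Reached (end₂ e) × end₁ e ≢ end₂ e

      record Block : Set where
        constructor block
        field
          left right : Edge        -- star edges from z to x = other left and to y = other right
          atLeft     : List Edge   -- further edges through x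
          bridge     : Edge        -- a further edge from x to y
          atRight    : List Edge   -- further edges through y
      open Block

      inner : Block → List Edge
      inner b = atLeft b ++ bridge b ∷ atRight b

      route : Block → List Edge
      route b = left b ∷ inner b ++ [ right b ]

      WellFormed : Block → Set
      WellFormed b =
        left b ∋ z × right b ∋ z × bridge b ∋ other (left b) × bridge b ∋ other (right b) ×
        All (_∋ other (left b)) (atLeft b) × All (_∋ other (right b)) (atRight b)

      routeWalk : ∀ {b} → WellFormed b → Walk z (route b) z
      routeWalk {b} (l∋z , r∋z , br∋x , br∋y , atX , atY) =
        step l∋z (∋-other (left b))
          ((pivot atX ++ʷ step br∋x br∋y (pivot atY)) ++ʷ step (∋-other (right b)) r∋z [])

      starsOf innersOf routes : List Block → List Edge
      starsOf  = concatMap λ b → left b ∷ right b ∷ []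
      innersOf = concatMap inner
      routes   = concatMap route

      routesWalk : ∀ {bs} → All WellFormed bs → Walk z (routes bs) z
      routesWalk []         = []
      routesWalk (wf ∷ wfs) = routeWalk wf ++ʷ routesWalk wfs

      routes↭ : ∀ bs → routes bs ↭ starsOf bs ++ innersOf bs
      routes↭ []       = ↭-refl
      routes↭ (b ∷ bs) = begin
        left b ∷ (inner b ++ [ right b ]) ++ routes bs
          ≡⟨ cong (left b ∷_) (++-assoc (inner b) _ _) ⟩
        left b ∷ inner b ++ right b ∷ routes bs
          ↭⟨ prep (left b) (shift (right b) (inner b) (routes bs)) ⟩
        left b ∷ right b ∷ inner b ++ routes bs
          ↭⟨ prep (left b) (prep (right b) (++⁺ˡ (inner b) (routes↭ bs))) ⟩
        left b ∷ right b ∷ inner b ++ starsOf bs ++ innersOf bs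
          ↭⟨ prep (left b) (prep (right b) (shifts (inner b) (starsOf bs))) ⟩
        left b ∷ right b ∷ starsOf bs ++ inner b ++ innersOf bs ∎
        where open PermutationReasoning

      record Layout (S : List Edge) : Set where
        constructor layout
        field
          blocks      : List Block
          spare       : List Edge
          wellFormed  : All WellFormed blocks
          splitsStars : starsOf blocks ++ spare ↭ stars
          coversS     : innersOf blocks ↭ S

        tour : List Edge
        tour = routes blocks ++ spare

        tourWalk : Walk z tour z
        tourWalk = routesWalk wellFormed ++ʷ
                   pivot (All.++⁻ʳ (starsOf blocks) (All-resp-↭ (↭-sym splitsStars) stars-at-z))

        tour↭ : tour ↭ stars ++ S
        tour↭ = begin
          routes blocks ++ spare                        ↭⟨ ++⁺ʳ spare (routes↭ blocks) ⟩
          (starsOf blocks ++ innersOf blocks) ++ spare  ≡⟨ ++-assoc (starsOf blocks) _ _ ⟩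
          starsOf blocks ++ innersOf blocks ++ spare
            ↭⟨ ++⁺ˡ (starsOf blocks) (++-comm (innersOf blocks) spare) ⟩
          starsOf blocks ++ spare ++ innersOf blocks    ≡⟨ ++-assoc (starsOf blocks) _ _ ⟨
          (starsOf blocks ++ spare) ++ innersOf blocks  ↭⟨ ++⁺ splitsStars coversS ⟩
          stars ++ S                                    ∎
          where open PermutationReasoning

      Touches : Vertex → Block → Set
      Touches v b = other (left b) ≡ v ⊎ other (right b) ≡ v

      touches? : ∀ v b → Dec (Touches v b)
      touches? v b = (other (left b) ≟ v) ⊎-dec (other (right b) ≟ v)

      starsOf-touch : ∀ {bs} → k ∈ starsOf bs → Any (Touches (other k)) bs
      starsOf-touch {bs = b ∷ _} (here k≡l)         = here (inj₁ (cong other (sym k≡l)))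
      starsOf-touch {bs = b ∷ _} (there (here k≡r)) = here (inj₂ (cong other (sym k≡r)))
      starsOf-touch {bs = b ∷ _} (there (there k∈)) = there (starsOf-touch k∈)

      insertLeft insertRight : Edge → Block → Block
      insertLeft  e b = record b { atLeft  = e ∷ atLeft b }
      insertRight e b = record b { atRight = e ∷ atRight b }

      insertRight↭ : ∀ e b → inner (insertRight e b) ↭ e ∷ inner b
      insertRight↭ e b = ↭-trans (++⁺ˡ (atLeft b) (swap (bridge b) e ↭-refl))
                                 (shift e (atLeft b) (bridge b ∷ atRight b))

      insert : ∀ {bs} → e ∋ v → Any (Touches v) bs → All WellFormed bs →
               Σ (List Block) λ bs′ →
                 All WellFormed bs′ × starsOf bs′ ≡ starsOf bs × innersOf bs′ ↭ e ∷ innersOf bs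
      insert {e} {bs = b ∷ bs} e∋v (here (inj₁ x≡v)) ((l , r , bx , by , atX , atY) ∷ wfs) =
        insertLeft e b ∷ bs ,
        (l , r , bx , by , subst (e ∋_) (sym x≡v) e∋v ∷ atX , atY) ∷ wfs , refl , ↭-refl
      insert {e} {bs = b ∷ bs} e∋v (here (inj₂ y≡v)) ((l , r , bx , by , atX , atY) ∷ wfs) =
        insertRight e b ∷ bs ,
        (l , r , bx , by , atX , subst (e ∋_) (sym y≡v) e∋v ∷ atY) ∷ wfs , refl ,
        ++⁺ʳ (innersOf bs) (insertRight↭ e b)
      insert {e} {bs = b ∷ bs} e∋v (there t) (wf ∷ wfs)
        with bs′ , wfs′ , stars≡ , inners↭ ← insert e∋v t wfs =
        b ∷ bs′ , wf ∷ wfs′ , cong (λ ks → left b ∷ right b ∷ ks) stars≡ ,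
        ↭-trans (++⁺ˡ (inner b) inners↭) (shift e (inner b) (innersOf bs))

      untouched⇒spare : ∀ {S} (L : Layout S) → k ∈ stars → other k ≡ v →
                        ¬ Any (Touches v) (Layout.blocks L) → k ∈ Layout.spare L
      untouched⇒spare (layout bs _ _ splits _) k∈ refl ¬t
        with ∈-++⁻ (starsOf bs) (∈-resp-↭ (↭-sym splits) k∈)
      ... | inj₁ k∈bs    = ⊥-elim (¬t (starsOf-touch k∈bs))
      ... | inj₂ k∈spare = k∈spare

      -- Adding one attachable edge e = {x,y} to a layout: if a block touches x or y, e joins it;
      -- otherwise the star edges to x and y are both spare and, with e, form a new block.
      extend : ∀ {S} → Layout S → Attachable e → Layout (e ∷ S)
      extend {e} L@(layout bs spare wfs splits covers) ((kx , kx∈ , kx→x) , (ky , ky∈ , ky→y) , x≢y)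
        with Any.any? (touches? (end₁ e)) bs
      ... | yes t with bs′ , wfs′ , stars≡ , inners↭ ← insert (inj₁ refl) t wfs =
        layout bs′ spare wfs′ (subst (λ ks → ks ++ spare ↭ stars) (sym stars≡) splits)
                              (↭-trans inners↭ (prep e covers))
      ... | no ¬tx with Any.any? (touches? (end₂ e)) bs
      ...   | yes t with bs′ , wfs′ , stars≡ , inners↭ ← insert (inj₂ refl) t wfs =
        layout bs′ spare wfs′ (subst (λ ks → ks ++ spare ↭ stars) (sym stars≡) splits)
                              (↭-trans inners↭ (prep e covers))
      ...   | no ¬ty
        with rest , spare↭ ← remove₂ (untouched⇒spare L kx∈ kx→x ¬tx) (untouched⇒spare L ky∈ ky→y ¬ty)
                                     (far-ends-differ kx→x ky→y x≢y) =
        layout (block kx ky [] e [] ∷ bs) rest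
          ((All.lookup stars-at-z kx∈ , All.lookup stars-at-z ky∈ ,
            inj₁ (sym kx→x) , inj₂ (sym ky→y) , [] , []) ∷ wfs)
          (begin
            kx ∷ ky ∷ starsOf bs ++ rest   ↭⟨ shifts (kx ∷ ky ∷ []) (starsOf bs) ⟩
            starsOf bs ++ kx ∷ ky ∷ rest   ↭⟨ ++⁺ˡ (starsOf bs) spare↭ ⟨
            starsOf bs ++ spare            ↭⟨ splits ⟩
            stars                          ∎)
          (prep e covers)
        where open PermutationReasoning

      layoutOf : ∀ S → All Attachable S → Layout S
      layoutOf []      []       = layout [] stars [] ↭-refl ↭-refl
      layoutOf (e ∷ S) (a ∷ as) = extend (layoutOf S as) a

      tourCycle : ∀ S → All Attachable S → Unique (stars ++ S) → 2 ≤ length stars + length S →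
                  HasCycleOfLength LineGraph (length stars + length S)
      tourCycle S attachable u 2≤len =
        subst (HasCycleOfLength LineGraph) len≡
          (closedWalk⇒cycle tourWalk (Unique-resp-↭ (↭-sym tour↭) u) (subst (2 ≤_) (sym len≡) 2≤len))
        where
        open Layout (layoutOf S attachable)
        len≡ : length tour ≡ length stars + length S
        len≡ = trans (↭-length tour↭) (length-++ stars)

    Neighbour : Vertex → Set
    Neighbour v = v ≢ z × Σ Edge λ k → k ∋ z × k ∋ v

    Degree≥3 : Set
    Degree≥3 = Σ Vertex λ u → Σ Vertex λ v → Σ Vertex λ w →
                 (Neighbour u × Neighbour v × Neighbour w) × (u ≢ v × u ≢ w × v ≢ w)

    -- Cycles of length k ≤ deg z use k star edges, which pairwise meet at z; longer cycles use
    -- all star edges and k − deg z further edges, arranged by `Tours`.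
    module _ (edges : List Edge) (edges-unique : Unique edges) (edges-complete : ∀ e → e ∈ edges)
             (loopless : ∀ e → end₁ e ≢ end₂ e)
             (joined-to-z : ∀ e v → e ∋ v → v ≢ z → Σ Edge λ k → k ∋ z × k ∋ v)
             (degree≥3 : Degree≥3) where

      stars others : List Edge
      stars  = filter (_∋? z) edges
      others = filter (∁? (_∋? z)) edges

      edges↭ : edges ↭ stars ++ others
      edges↭ = subst (λ p → edges ↭ proj₁ p ++ proj₂ p) (partition-defn (_∋? z) edges)
                     (↭ₛ⇒↭ (Perm.partition-↭ (setoid Edge) (_∋? z) edges))

      length-edges : length edges ≡ length stars + length others
      length-edges = trans (↭-length edges↭) (length-++ stars)

      stars-unique : Unique stars
      stars-unique = Unique-resp-⊇ (Sublist.filter-⊆ (_∋? z) edges) edges-unique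

      stars-at-z : All (_∋ z) stars
      stars-at-z = All.tabulate (proj₂ ∘ ∈-filter⁻ (_∋? z) {xs = edges})

      3≤stars : 3 ≤ length stars
      3≤stars =
        let u , v , w , (nu , nv , nw) , (u≢v , u≢w , v≢w) = degree≥3
        in three≤length (isStar nu) (isStar nv) (isStar nw)
             (far-ends-differ (farEnd nu) (farEnd nv) u≢v)
             (far-ends-differ (farEnd nu) (farEnd nw) u≢w)
             (far-ends-differ (farEnd nv) (farEnd nw) v≢w)
        where
        isStar : ∀ {v} (nv : Neighbour v) → proj₁ (proj₂ nv) ∈ stars
        isStar (_ , k , k∋z , _) = ∈-filter⁺ (_∋? z) (edges-complete k) k∋z
        farEnd : ∀ {v} (nv : Neighbour v) → other (proj₁ (proj₂ nv)) ≡ v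
        farEnd (v≢z , _ , k∋z , k∋v) = other-unique k∋z k∋v v≢z

      open Tours stars stars-at-z

      others-attachable : All Attachable others
      others-attachable =
        All.tabulate λ {e} e∈ → attachable e (proj₂ (∈-filter⁻ (∁? (_∋? z)) {xs = edges} e∈))
        where
        reached : ∀ e v → e ∋ v → ¬ e ∋ z → Reached v
        reached e v e∋v e∌z with k , k∋z , k∋v ← joined-to-z e v e∋v (λ { refl → e∌z e∋v }) =
          k , ∈-filter⁺ (_∋? z) (edges-complete k) k∋z , other-unique k∋z k∋v (λ { refl → e∌z e∋v })
        attachable : ∀ e → ¬ e ∋ z → Attachable e
        attachable e e∌z = reached e (end₁ e) (inj₁ refl) e∌z , reached e (end₂ e) (inj₂ refl) e∌z ,
                           loopless e

      starCycle : ∀ k → 2 ≤ k → k ≤ length stars → HasCycleOfLength LineGraph k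
      starCycle k 2≤k k≤stars =
        subst (HasCycleOfLength LineGraph) len≡
          (closedWalk⇒cycle (pivot (All.take⁺ k stars-at-z))
            (Unique-resp-⊇ (take-⊆ k stars) stars-unique)
            (subst (2 ≤_) (sym len≡) 2≤k))
        where
        len≡ : length (take k stars) ≡ k
        len≡ = trans (length-take k stars) (ℕ.m≤n⇒m⊓n≡m k≤stars)

      tourCycleWith : ∀ j → j ≤ length others → HasCycleOfLength LineGraph (length stars + j)
      tourCycleWith j j≤others =
        subst (λ i → HasCycleOfLength LineGraph (length stars + i)) len≡
          (tourCycle (take j others) (All.take⁺ j others-attachable)
            (Unique-resp-⊇ (Sublist.++⁺ ⊆-refl (take-⊆ j others)) (Unique-resp-↭ edges↭ edges-unique))
            (ℕ.≤-trans (ℕ.<⇒≤ 3≤stars) (ℕ.m≤m+n (length stars) _)))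
        where
        len≡ : length (take j others) ≡ j
        len≡ = trans (length-take j others) (ℕ.m≤n⇒m⊓n≡m j≤others)

      lineGraph-pancyclic : Pancyclic LineGraph
      lineGraph-pancyclic =
        length edges , enumeration edges-unique edges-complete ,
        ℕ.≤-trans 3≤stars (length-filter (_∋? z) edges) , cycle
        where
        cycle : ∀ k → 3 ≤ k → k ≤ length edges → HasCycleOfLength LineGraph k
        cycle k 3≤k k≤edges with k ≤? length stars
        ... | yes k≤stars = starCycle k (ℕ.<⇒≤ 3≤k) k≤stars
        ... | no  k≰stars =
          subst (HasCycleOfLength LineGraph) (ℕ.m+[n∸m]≡n stars≤k)
            (tourCycleWith (k ∸ length stars)
              (ℕ.≤-trans (ℕ.∸-monoˡ-≤ (length stars) (subst (k ≤_) length-edges k≤edges))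
                         (ℕ.≤-reflexive (ℕ.m+n∸m≡n (length stars) (length others)))))
          where
          stars≤k : length stars ≤ k
          stars≤k = ℕ.≰⇒≥ k≰stars

-- Arithmetic of ℤ_N[i] written in ℕ: x = a + bi, y = c + di, and −1 represented by N − 1.

2-prime : Prime 2
2-prime = from-yes (prime? 2)

∣-drop-multiple : ∀ N s t → N ∣ s + N * t → N ∣ s
∣-drop-multiple N s t N∣ = ∣m+n∣m⇒∣n (subst (N ∣_) (+-comm s (N * t)) N∣) (m∣m*n t)

-- If xy = 0 in ℤ_N[i] then (a² + b²) y = x̄ (x y) = 0: the norm of x annihilates y.
norm-annihilates : ∀ N a b c d → 2 ≤ N →
                   N ∣ a * c + (N ∸ 1) * (b * d) → N ∣ a * d + b * c →
                   N ∣ (a * a + b * b) * c × N ∣ (a * a + b * b) * d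
norm-annihilates (suc (suc k)) a b c d (s≤s (s≤s _)) re im =
  ∣-drop-multiple N _ (a * b * d)
    (subst (N ∣_) (real-part a b c d k) (∣m∣n⇒∣m+n (∣n⇒∣m*n a re) (∣n⇒∣m*n b im))) ,
  ∣-drop-multiple N _ (a * b * c + k * (b * b * d))
    (subst (N ∣_) (imaginary-part a b c d k) (∣m∣n⇒∣m+n (∣n⇒∣m*n a im) (∣n⇒∣m*n (suc k * b) re)))
  where
  N : ℕ
  N = suc (suc k)
  -- a·Re(xy) + b·Im(xy) and a·Im(xy) − b·Re(xy), i.e. x̄·(xy), up to multiples of N
  real-part : ∀ a b c d k →
              a * (a * c + suc k * (b * d)) + b * (a * d + b * c) ≡
              (a * a + b * b) * c + suc (suc k) * (a * b * d)
  real-part = solve-∀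
  imaginary-part : ∀ a b c d k →
                   a * (a * d + b * c) + suc k * b * (a * c + suc k * (b * d)) ≡
                   (a * a + b * b) * d + suc (suc k) * (a * b * c + k * (b * b * d))
  imaginary-part = solve-∀

odd-norm : ∀ a b → ¬ 2 ∣ a + b → ¬ 2 ∣ a * a + b * b
odd-norm a b odd 2∣norm with euclidsLemma (a + b) (a + b) 2-prime
                               (subst (2 ∣_) (sym (square a b)) (∣m∣n⇒∣m+n 2∣norm (m∣m*n (a * b))))
  where
  square : ∀ a b → (a + b) * (a + b) ≡ (a * a + b * b) + 2 * (a * b)
  square = solve-∀
... | inj₁ 2∣ = odd 2∣
... | inj₂ 2∣ = odd 2∣

odd-cancel : ∀ m s c → ¬ 2 ∣ s → 2 ^ m ∣ s * c → 2 ^ m ∣ c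
odd-cancel zero    s c _   _ = 1∣ c
odd-cancel (suc m) s c odd 2^m+1∣ with euclidsLemma s c 2-prime (m*n∣⇒m∣ 2 (2 ^ m) 2^m+1∣)
... | inj₁ 2∣s = ⊥-elim (odd 2∣s)
... | inj₂ (divides q refl) =
  subst (2 * 2 ^ m ∣_) (*-comm 2 q)
    (*-monoʳ-∣ 2 (odd-cancel m s q odd (*-cancelˡ-∣ 2 (subst (2 * 2 ^ m ∣_) (regroup s q) 2^m+1∣))))
  where
  regroup : ∀ s q → s * (q * 2) ≡ 2 * (s * q)
  regroup = solve-∀

-- In ℤ_{2h}[i], the element h(1 + i) annihilates every a + bi with a + b even:
-- h(1 + i)(a + bi) = h(a − b) + h(a + b) i.
half-annihilates : ∀ h a b → 2 ∣ a + b →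
                   2 * h ∣ h * a + (2 * h ∸ 1) * (h * b) × 2 * h ∣ h * b + h * a
half-annihilates zero     a b _                = ∣-refl , ∣-refl
half-annihilates (suc h′) a b (divides t a+b≡) =
  subst (2 * h ∣_) (sym real-part) (∣m∣n⇒∣m+n (m∣m*n t) (m∣m*n (h′ * b))) ,
  subst (2 * h ∣_) (sym imaginary-part) (m∣m*n t)
  where
  open ≡-Reasoning
  h : ℕ
  h = suc h′
  spread : ∀ h′ a b → suc h′ * a + (h′ + (suc h′ + 0)) * (suc h′ * b) ≡
                      suc h′ * (a + b) + 2 * suc h′ * (h′ * b)
  spread = solve-∀
  regroup : ∀ h′ t → suc h′ * (t * 2) ≡ 2 * suc h′ * t
  regroup = solve-∀
  real-part : h * a + (2 * h ∸ 1) * (h * b) ≡ 2 * h * t + 2 * h * (h′ * b)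
  real-part = begin
    h * a + (h′ + (h + 0)) * (h * b)  ≡⟨ spread h′ a b ⟩
    h * (a + b) + 2 * h * (h′ * b)    ≡⟨ cong (λ s → h * s + 2 * h * (h′ * b)) a+b≡ ⟩
    h * (t * 2) + 2 * h * (h′ * b)    ≡⟨ cong (_+ 2 * h * (h′ * b)) (regroup h′ t) ⟩
    2 * h * t + 2 * h * (h′ * b)      ∎
  imaginary-part : h * b + h * a ≡ 2 * h * t
  imaginary-part = begin
    h * b + h * a  ≡⟨ +-comm (h * b) _ ⟩
    h * a + h * b  ≡⟨ *-distribˡ-+ h a b ⟨
    h * (a + b)    ≡⟨ cong (h *_) a+b≡ ⟩
    h * (t * 2)    ≡⟨ regroup h′ t ⟩
    2 * h * t      ∎

module GaussianMod (n : ℕ) .{{_ : NonZero n}} where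

  private variable
    x y : ZnI n

  _≟ᶻ_ : DecidableEquality (ZnI n)
  _≟ᶻ_ = ≡-dec _≟ᶠ_ _≟ᶠ_

  IsZero : ZnI n → Set
  IsZero x = T (isZero n x)

  infixl 7 _·_
  _·_ : ZnI n → ZnI n → ZnI n
  _·_ = mulZnI n

  0ᶠ : Fin n
  0ᶠ = modFin n 0

  toℕ-modFin : ∀ X → toℕ (modFin n X) ≡ X % n
  toℕ-modFin X = toℕ-fromℕ< (m%n<n X n)

  toℕ-0ᶠ : toℕ 0ᶠ ≡ 0
  toℕ-0ᶠ = trans (toℕ-modFin 0) (m<n⇒m%n≡m (>-nonZero⁻¹ n))

  modFin≡0⇒∣ : ∀ X → modFin n X ≡ 0ᶠ → n ∣ X
  modFin≡0⇒∣ X eq = m%n≡0⇒n∣m X n (trans (sym (toℕ-modFin X)) (trans (cong toℕ eq) toℕ-0ᶠ))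

  ∣⇒modFin≡0 : ∀ X → n ∣ X → modFin n X ≡ 0ᶠ
  ∣⇒modFin≡0 X n∣X = toℕ-injective (trans (toℕ-modFin X) (trans (n∣m⇒m%n≡0 X n n∣X) (sym toℕ-0ᶠ)))

  divisible⇒0ᶠ : ∀ a → n ∣ toℕ a → a ≡ 0ᶠ
  divisible⇒0ᶠ a n∣a = trans (sym modFin-toℕ) (∣⇒modFin≡0 (toℕ a) n∣a)
    where
    modFin-toℕ : modFin n (toℕ a) ≡ a
    modFin-toℕ = toℕ-injective (trans (toℕ-modFin (toℕ a)) (m<n⇒m%n≡m (toℕ<n a)))

  isZero⇒ : ∀ a b → IsZero (a , b) → a ≡ 0ᶠ × b ≡ 0ᶠ
  isZero⇒ a b t with ta , tb ← Equivalence.to T-∧ t =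
    toWitness {a? = a ≟ᶠ 0ᶠ} ta , toWitness {a? = b ≟ᶠ 0ᶠ} tb

  isZero⇐ : ∀ a b → a ≡ 0ᶠ → b ≡ 0ᶠ → IsZero (a , b)
  isZero⇐ a b a≡0 b≡0 =
    Equivalence.from T-∧ (fromWitness {a? = a ≟ᶠ 0ᶠ} a≡0 , fromWitness {a? = b ≟ᶠ 0ᶠ} b≡0)

  nonzero : ∀ {a b} → toℕ a ≢ 0 ⊎ toℕ b ≢ 0 → ¬ IsZero (a , b)
  nonzero {a} {b} a≢0⊎b≢0 t with isZero⇒ a b t | a≢0⊎b≢0
  ... | a≡0 , _ | inj₁ a≢0 = a≢0 (trans (cong toℕ a≡0) toℕ-0ᶠ)
  ... | _ , b≡0 | inj₂ b≢0 = b≢0 (trans (cong toℕ b≡0) toℕ-0ᶠ)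

  product-zero⇒ : ∀ a b c d → IsZero ((a , b) · (c , d)) →
                  n ∣ toℕ a * toℕ c + (n ∸ 1) * (toℕ b * toℕ d) × n ∣ toℕ a * toℕ d + toℕ b * toℕ c
  product-zero⇒ a b c d t with re≡0 , im≡0 ← isZero⇒ _ _ t = modFin≡0⇒∣ _ re≡0 , modFin≡0⇒∣ _ im≡0

  product-zero⇐ : ∀ a b c d →
                  n ∣ toℕ a * toℕ c + (n ∸ 1) * (toℕ b * toℕ d) → n ∣ toℕ a * toℕ d + toℕ b * toℕ c →
                  IsZero ((a , b) · (c , d))
  product-zero⇐ a b c d n∣re n∣im = isZero⇐ _ _ (∣⇒modFin≡0 _ n∣re) (∣⇒modFin≡0 _ n∣im)

  product-zero-comm : ∀ x y → IsZero (x · y) → IsZero (y · x)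
  product-zero-comm (a , b) (c , d) t with n∣re , n∣im ← product-zero⇒ a b c d t =
    product-zero⇐ c d a b
      (subst (n ∣_) (cong₂ _+_ (*-comm (toℕ a) _) (cong ((n ∸ 1) *_) (*-comm (toℕ b) _))) n∣re)
      (subst (n ∣_) (trans (+-comm (toℕ a * toℕ d) _)
                           (cong₂ _+_ (*-comm (toℕ b) _) (*-comm (toℕ a) _))) n∣im)

  code-injective : ∀ x y → code n x ≡ code n y → x ≡ y
  code-injective (a , b) (c , d) eq =
    let a≡c , b≡d = combine-injective a b c d
                      (toℕ-injective (trans (as-code a b) (trans eq (sym (as-code c d)))))
    in cong₂ _,_ a≡c b≡d
    where
    as-code : ∀ a b → toℕ (combine {n} {n} a b) ≡ code n (a , b)
    as-code a b = trans (toℕ-combine a b) (cong (_+ toℕ b) (*-comm n (toℕ a)))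

  isEdge⇐ : ∀ x y → code n x < code n y → ¬ IsZero x → ¬ IsZero y → IsZero (x · y) →
            T (isEdgeΓ n x y)
  isEdge⇐ x y x<y x≢0 y≢0 xy≡0 =
    Equivalence.from T-∧ (ℕ.<⇒<ᵇ x<y , Equivalence.from T-∧ (¬T⇒Tnot x≢0 ,
      Equivalence.from T-∧ (¬T⇒Tnot y≢0 , xy≡0)))
    where
    ¬T⇒Tnot : ∀ {b} → ¬ T b → T (not b)
    ¬T⇒Tnot {false} _ = tt
    ¬T⇒Tnot {true} ¬t = ¬t tt

  isEdge⇒ : ∀ x y → T (isEdgeΓ n x y) →
            code n x < code n y × ¬ IsZero x × ¬ IsZero y × IsZero (x · y)
  isEdge⇒ x y t =
    let x<y , t′ = Equivalence.to T-∧ t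
        x≢0 , t″ = Equivalence.to T-∧ t′
        y≢0 , xy≡0 = Equivalence.to T-∧ t″
    in ℕ.<ᵇ⇒< (code n x) (code n y) x<y , Tnot⇒¬T x≢0 , Tnot⇒¬T y≢0 , xy≡0
    where
    Tnot⇒¬T : ∀ {b} → T (not b) → ¬ T b
    Tnot⇒¬T {false} _ ()

  open LineGraphs (endpoint₁ n) (endpoint₂ n) _≟ᶻ_ public

  edge-between : x ≢ y → ¬ IsZero x → ¬ IsZero y → IsZero (x · y) →
                 Σ (EdgeΓ n) λ e → e ∋ x × e ∋ y
  edge-between {x} {y} x≢y x≢0 y≢0 xy≡0 with ℕ.<-cmp (code n x) (code n y)
  ... | tri< x<y _ _ = ((x , y) , isEdge⇐ x y x<y x≢0 y≢0 xy≡0) , inj₁ refl , inj₂ refl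
  ... | tri≈ _ eq _  = ⊥-elim (x≢y (code-injective x y eq))
  ... | tri> _ _ y<x =
    ((y , x) , isEdge⇐ y x y<x y≢0 x≢0 (product-zero-comm x y xy≡0)) , inj₂ refl , inj₁ refl

  loopless : ∀ e → endpoint₁ n e ≢ endpoint₂ n e
  loopless ((x , y) , t) x≡y =
    ℕ.<-irrefl (cong (code n) x≡y) (proj₁ (isEdge⇒ x y t))

  endpoint-zero-divisor : ∀ e {v} → e ∋ v →
                          ¬ IsZero v × Σ (ZnI n) λ w → ¬ IsZero w × IsZero (v · w)
  endpoint-zero-divisor ((x , y) , t) (inj₁ refl) =
    let _ , x≢0 , y≢0 , xy≡0 = isEdge⇒ x y t in x≢0 , y , y≢0 , xy≡0
  endpoint-zero-divisor ((x , y) , t) (inj₂ refl) =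
    let _ , x≢0 , y≢0 , xy≡0 = isEdge⇒ x y t in y≢0 , x , x≢0 , product-zero-comm x y xy≡0

  elements : List (ZnI n)
  elements = cartesianProduct (allFin n) (allFin n)

  elements-unique : Unique elements
  elements-unique = Unique.cartesianProduct⁺ (Unique.allFin⁺ n) (Unique.allFin⁺ n)

  ∈-elements : ∀ x → x ∈ elements
  ∈-elements (a , b) = ∈-cartesianProduct⁺ (∈-allFin a) (∈-allFin b)

  edges : List (EdgeΓ n)
  edges = witnesses (λ p → isEdgeΓ n (proj₁ p) (proj₂ p)) (cartesianProduct elements elements)

  edges-complete : ∀ e → e ∈ edges
  edges-complete e@((x , y) , _) =
    witnesses-complete _ e (∈-cartesianProduct⁺ (∈-elements x) (∈-elements y))

  edges-unique : Unique edges
  edges-unique = witnesses-unique _ (Unique.cartesianProduct⁺ elements-unique elements-unique)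

-- ℤ_n[i] for n = 2^(m+2) = 2h, and the vertex z = h(1 + i) of Γ(ℤ_n[i]), which is joined to
-- every other vertex: zero-divisors lie in the ideal (1 + i), and z annihilates that ideal.
module PowerOfTwo (m : ℕ) where

  -- n = 2^(m+2) = 2h, definitionally
  h n : ℕ
  h = 2 ^ suc m
  n = 2 * h

  instance
    n≢0 : NonZero n
    n≢0 = ℕ.m^n≢0 2 (suc (suc m))

  open GaussianMod n public

  2≤h : 2 ≤ h
  2≤h = ℕ.*-monoʳ-≤ 2 (ℕ.m^n>0 2 m)

  h<n : h < n
  h<n = ℕ.m<m+n h (ℕ.<-≤-trans (ℕ.m^n>0 2 (suc m)) (ℕ.m≤m+n h 0))

  2<n : 2 < n
  2<n = ℕ.≤-<-trans 2≤h h<n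

  hᶠ 1ᶠ 2ᶠ : Fin n
  hᶠ = fromℕ< h<n
  1ᶠ = fromℕ< (ℕ.<-trans (s≤s (s≤s z≤n)) 2<n)
  2ᶠ = fromℕ< 2<n

  toℕ-hᶠ : toℕ hᶠ ≡ h
  toℕ-hᶠ = toℕ-fromℕ< h<n

  toℕ-1ᶠ : toℕ 1ᶠ ≡ 1
  toℕ-1ᶠ = toℕ-fromℕ< _

  toℕ-2ᶠ : toℕ 2ᶠ ≡ 2
  toℕ-2ᶠ = toℕ-fromℕ< _

  z : ZnI n
  z = hᶠ , hᶠ

  h≢0 : h ≢ 0
  h≢0 = ℕ.>⇒≢ (ℕ.<-≤-trans (s≤s z≤n) 2≤h)

  z≢0 : ¬ IsZero z
  z≢0 = nonzero (inj₁ (λ hᶠ≡0 → h≢0 (trans (sym toℕ-hᶠ) hᶠ≡0)))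

  -- Every zero-divisor a + bi has a + b even: otherwise its norm a² + b² is odd, hence a unit
  -- modulo 2^(m+2), and (a² + b²) y = 0 would force y = 0.
  zero-divisor⇒even : ∀ a b y → ¬ IsZero y → IsZero ((a , b) · y) → 2 ∣ toℕ a + toℕ b
  zero-divisor⇒even a b (c , d) y≢0 xy≡0 with 2 ∣? (toℕ a + toℕ b)
  ... | yes even = even
  ... | no  odd  =
    let re , im = product-zero⇒ a b c d xy≡0
        norm·c , norm·d = norm-annihilates n (toℕ a) (toℕ b) (toℕ c) (toℕ d) (ℕ.<⇒≤ 2<n) re im
    in ⊥-elim (y≢0 (isZero⇐ c d (divisible⇒0ᶠ c (cancel norm·c)) (divisible⇒0ᶠ d (cancel norm·d))))
    where
    cancel : ∀ {t} → n ∣ (toℕ a * toℕ a + toℕ b * toℕ b) * t → n ∣ t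
    cancel = odd-cancel (suc (suc m)) _ _ (odd-norm (toℕ a) (toℕ b) odd)

  z-annihilates : ∀ a b → 2 ∣ toℕ a + toℕ b → IsZero (z · (a , b))
  z-annihilates a b even =
    let re , im = half-annihilates h (toℕ a) (toℕ b) even
    in product-zero⇐ hᶠ hᶠ a b
         (subst (λ t → n ∣ t * toℕ a + (n ∸ 1) * (t * toℕ b)) (sym toℕ-hᶠ) re)
         (subst (λ t → n ∣ t * toℕ b + t * toℕ a) (sym toℕ-hᶠ) im)

  edge-to-z : ∀ w → w ≢ z → ¬ IsZero w → 2 ∣ toℕ (proj₁ w) + toℕ (proj₂ w) →
              Σ (EdgeΓ n) λ k → k ∋ z × k ∋ w
  edge-to-z w w≢z w≢0 even = edge-between (w≢z ∘ sym) z≢0 w≢0 (z-annihilates _ _ even)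

  joined-to-z : ∀ e v → e ∋ v → v ≢ z → Σ (EdgeΓ n) λ k → k ∋ z × k ∋ v
  joined-to-z e v@(a , b) e∋v v≢z =
    let v≢0 , w , w≢0 , vw≡0 = endpoint-zero-divisor e e∋v
    in edge-to-z v v≢z v≢0 (zero-divisor⇒even a b w w≢0 vw≡0)

  open Cone z public

  degree≥3 : Degree≥3
  degree≥3 =
    (1ᶠ , 1ᶠ) , (2ᶠ , 0ᶠ) , (0ᶠ , 2ᶠ) ,
    ( neighbour toℕ-1ᶠ toℕ-1ᶠ (inj₁ 1≢h) (inj₁ λ ()) ∣-refl
    , neighbour toℕ-2ᶠ toℕ-0ᶠ (inj₂ 0≢h) (inj₁ λ ()) ∣-refl
    , neighbour toℕ-0ᶠ toℕ-2ᶠ (inj₁ 0≢h) (inj₂ λ ()) ∣-refl ) ,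
    ( differ toℕ-1ᶠ toℕ-2ᶠ (λ ()) , differ toℕ-1ᶠ toℕ-0ᶠ (λ ()) , differ toℕ-2ᶠ toℕ-0ᶠ (λ ()) )
    where
    1≢h : 1 ≢ h
    1≢h = ℕ.<⇒≢ 2≤h
    0≢h : 0 ≢ h
    0≢h = h≢0 ∘ sym
    neighbour : ∀ {a b : Fin n} {i j} → toℕ a ≡ i → toℕ b ≡ j →
                i ≢ h ⊎ j ≢ h → i ≢ 0 ⊎ j ≢ 0 → 2 ∣ i + j → Neighbour (a , b)
    neighbour {a} {b} refl refl ≢hh ≢00 even =
      w≢z ≢hh , edge-to-z (a , b) (w≢z ≢hh) (nonzero ≢00) even
      where
      w≢z : toℕ a ≢ h ⊎ toℕ b ≢ h → (a , b) ≢ z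
      w≢z (inj₁ a≢h) refl = a≢h toℕ-hᶠ
      w≢z (inj₂ b≢h) refl = b≢h toℕ-hᶠ
    differ : ∀ {a b c d : Fin n} {i j} → toℕ a ≡ i → toℕ c ≡ j → i ≢ j → (a , b) ≢ (c , d)
    differ a≡i c≡j i≢j refl = i≢j (trans (sym a≡i) c≡j)

theorem3p7 : (m : ℕ) → 2 ≤ m → Pancyclic (LΓZ2^m[i] m)
theorem3p7 (suc (suc m)) (s≤s (s≤s _)) =
  lineGraph-pancyclic edges edges-unique edges-complete loopless joined-to-z degree≥3
  where open PowerOfTwo m
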